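{- Let $n\ge 2$ be an integer. There is a one-to-one correspondence (bijection) between the set $\Sigma_{n^2}$ of $n^2\times n^2$ S-permutation matrices and the set $\Pi_n$.
   Context: An $n^2\times n^2$ S-permutation matrix is an $n^2\times n^2$ permutation matrix (binary, exactly one $1$ in each row and each column) which, when partitioned into $n^2$ consecutive square $n\times n$ blocks $A_{st}$, $1\le s,t\le n$ (block $A_{st}$ occupying rows $(s-1)n+1,\dots,sn$ and columns $(t-1)n+1,\dots,tn$), has exactly one entry equal to $1$ in each block. $\Sigma_{n^2}$ is the set of all of them. $\Pi_n$ is the set of all $n\times n$ matrices $\pi$ whose entries are ordered pairs $\langle a,b\rangle$ with $a,b\in\{1,\dots,n\}$ such that: in each row of $\pi$, the first components of the entries (read left to right) form a permutation of $\{1,\dots,n\}$; and in each column of $\pi$, the second components of the entries (read top to bottom) form a permutation of $\{1,\dots,n\}$. -}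

module Defs where

open import Data.Nat using (ℕ)
open import Data.Fin using (Fin; combine)
open import Data.Bool using (Bool; true)
open import Data.Product using (Σ; ∃!; _×_; proj₁; proj₂)
open import Relation.Binary.PropositionalEquality using (_≡_; refl; sym; trans; isEquivalence)
open import Relation.Binary.Bundles using (Setoid)
open import Function.Definitions using (Bijective)

BinMatrix : ℕ → Set
BinMatrix n = Fin (n Data.Nat.* n) → Fin (n Data.Nat.* n) → Bool

IsPermutationMatrix : ∀ {n} → BinMatrix n → Set
IsPermutationMatrix {n} M =
  (∀ r → ∃! _≡_ (λ c → M r c ≡ true)) ×
  (∀ c → ∃! _≡_ (λ r → M r c ≡ true))

-- Block A_st (0-indexed s t) occupies rows s*n + i and columns t*n + j,
-- i, j : Fin n; `combine s i` is exactly s*n + i.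
-- Exactly one 1 in each block.
OneInEachBlock : ∀ {n} → BinMatrix n → Set
OneInEachBlock {n} M =
  ∀ (s t : Fin n) → ∃! _≡_ (λ (ij : Fin n × Fin n) →
     M (combine s (proj₁ ij)) (combine t (proj₂ ij)) ≡ true)

IsSPermutationMatrix : ∀ {n} → BinMatrix n → Set
IsSPermutationMatrix {n} M = IsPermutationMatrix {n} M × OneInEachBlock {n} M

SigmaSetoid : ℕ → Setoid _ _
SigmaSetoid n = record
  { Carrier = Σ (BinMatrix n) (IsSPermutationMatrix {n})
  ; _≈_ = λ A B → ∀ r c → proj₁ A r c ≡ proj₁ B r c
  ; isEquivalence = record
    { refl = λ r c → refl
    ; sym = λ p r c → sym (p r c)
    ; trans = λ p q r c → trans (p r c) (q r c) } }

-- n×n matrices of ordered pairs ⟨a,b⟩, a b ∈ {1..n} (here 0-indexed Fin n).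
PairMatrix : ℕ → Set
PairMatrix n = Fin n → Fin n → Fin n × Fin n

IsPi : ∀ {n} → PairMatrix n → Set
IsPi {n} π =
  (∀ i → Bijective _≡_ _≡_ (λ j → proj₁ (π i j))) ×
  (∀ j → Bijective _≡_ _≡_ (λ i → proj₂ (π i j)))

PiSetoid : ℕ → Setoid _ _
PiSetoid n = record
  { Carrier = Σ (PairMatrix n) IsPi
  ; _≈_ = λ A B → ∀ i j → proj₁ A i j ≡ proj₁ B i j
  ; isEquivalence = record
    { refl = λ i j → refl
    ; sym = λ p i j → sym (p i j)
    ; trans = λ p q i j → trans (p i j) (q i j) } }

module Submission where

-- A binary n²×n² matrix M and a pair matrix π "encode" each other when, for
-- all block indices s t and in-block offsets i j, the entry of M in row s·n+i
-- and column t·n+j is 1 exactly when π s t = ⟨i , j⟩.  The whole proof is a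
-- study of this relation:
--   * every matrix with one 1 per block encodes the matrix of its block
--     positions, and every pair matrix is encoded by an explicit 0/1 matrix;
--   * an encoding matrix has one 1 in each block, and it is a permutation
--     matrix iff the encoded π lies in Π_n.  Via the bijection
--     Fin (n·n) ≅ Fin n × Fin n, "row s·n+i has a unique 1" becomes "exactly
--     one t has first(π s t) = i", i.e. row s of π permutes its first
--     components (dually for columns);
--   * encodings determine each other up to entrywise equality.
-- The bijection sends an S-permutation matrix to its block positions; the
-- three facts give well-definedness, injectivity and surjectivity.

open import Level using (Level; 0ℓ)
open import Data.Nat using (ℕ; _≤_)
open import Data.Fin using (Fin; combine; remQuot; _≟_)
open import Data.Fin.Properties using (*↔×; combine-surjective; remQuot-combine)
open import Data.Bool using (Bool; true)
open import Data.Bool.Properties using (⇔→≡)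
open import Data.Empty using (⊥-elim)
open import Data.Product using (Σ; ∃; ∃!; _×_; _,_; proj₁; proj₂; swap; curry; uncurry)
open import Data.Product.Properties using (≡-dec; ×-≡,≡→≡)
open import Relation.Nullary using (Dec; yes; no; does)
open import Relation.Binary.PropositionalEquality using (_≡_; refl; sym; trans; cong; subst; subst₂)
open import Function using (_∘_; id)
open import Function.Bundles using (Bijection; Inverse; _↔_; _⇔_; mk⇔; Equivalence)
open import Function.Definitions using (Bijective)
open import Function.Properties.Equivalence using (⇔-setoid)
open import Function.Construct.Composition using (_⇔-∘_)
open import Data.Product.Function.NonDependent.Propositional using (_×-⇔_)
open import Defs

open Equivalence using (to; from)

private
  variable
    a b c : Level
    A B T : Set a

∀-cong : {P Q : A → Set b} → (∀ x → P x ⇔ Q x) → (∀ x → P x) ⇔ (∀ x → Q x)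
∀-cong P⇔Q = mk⇔ (λ p x → to (P⇔Q x) (p x)) (λ q x → from (P⇔Q x) (q x))

∃!-cong : {P Q : A → Set b} → (∀ x → P x ⇔ Q x) → ∃! _≡_ P ⇔ ∃! _≡_ Q
∃!-cong P⇔Q =
  mk⇔ (λ (x , p , u) → x , to (P⇔Q x) p , λ {y} q → u (from (P⇔Q y) q))
      (λ (x , q , u) → x , from (P⇔Q x) q , λ {y} p → u (to (P⇔Q y) p))

∀-reindex : (e : A ↔ B) {P : A → Set c} →
            (∀ x → P x) ⇔ (∀ y → P (Inverse.from e y))
∀-reindex e {P} = mk⇔ (λ p y → p (Inverse.from e y))
  (λ p x → subst P (Inverse.strictlyInverseʳ e x) (p (Inverse.to e x)))

∃!-reindex : (e : A ↔ B) {P : A → Set c} →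
             ∃! _≡_ P ⇔ ∃! _≡_ (λ y → P (Inverse.from e y))
∃!-reindex e {P} = mk⇔
  (λ (x , p , u) →
     forth x , subst P (sym (back∘forth x)) p ,
     λ {y} q → trans (cong forth (u q)) (forth∘back y))
  (λ (y , q , u) →
     back y , q ,
     λ {x} p → trans (cong back (u (subst P (sym (back∘forth x)) p))) (back∘forth x))
  where
  open Inverse e using () renaming
    (to to forth; from to back;
     strictlyInverseˡ to forth∘back; strictlyInverseʳ to back∘forth)

-- For f : T → A × B and a fixed x, the pairs (t , y) with f t = (x , y)
-- are in bijection with the t such that proj₁ (f t) = x, since y is then
-- forced to be proj₂ (f t).
∃!-fibre : (f : T → A × B) (x : A) →
           ∃! _≡_ (λ ((t , y) : T × B) → f t ≡ (x , y)) ⇔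
           ∃! _≡_ (λ t → proj₁ (f t) ≡ x)
∃!-fibre f x = mk⇔
  (λ ((t , y) , e , u) →
     t , cong proj₁ e , λ {t′} e′ → cong proj₁ (u (cong (_, proj₂ (f t′)) e′)))
  (λ (t , e , u) →
     (t , proj₂ (f t)) , cong (_, proj₂ (f t)) e ,
     λ {(t′ , y′)} e′ →
       let t≡t′ = u (cong proj₁ e′)
       in ×-≡,≡→≡ (t≡t′ , trans (cong (proj₂ ∘ f) t≡t′) (cong proj₂ e′)))

bijective⇔unique-preimages : (f : A → B) →
  Bijective _≡_ _≡_ f ⇔ (∀ y → ∃! _≡_ (λ x → f x ≡ y))
bijective⇔unique-preimages f = mk⇔ unique bijective
  where
  unique : Bijective _≡_ _≡_ f → ∀ y → ∃! _≡_ (λ x → f x ≡ y)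
  unique (inj , surj) y with surj y
  ... | x , fx≡y = x , fx≡y refl , λ e → inj (trans (fx≡y refl) (sym e))

  bijective : (∀ y → ∃! _≡_ (λ x → f x ≡ y)) → Bijective _≡_ _≡_ f
  bijective fibres = injective , surjective
    where
    injective : ∀ {x x′} → f x ≡ f x′ → x ≡ x′
    injective {x} {x′} fx≡fx′ with fibres (f x′)
    ... | _ , _ , u = trans (sym (u fx≡fx′)) (u refl)

    surjective : ∀ y → ∃ λ x → ∀ {z} → z ≡ x → f z ≡ y
    surjective y with fibres y
    ... | x , fx≡y , _ = x , λ z≡x → trans (cong f z≡x) fx≡y

does≡true⇔ : (p? : Dec A) → does p? ≡ true ⇔ A
does≡true⇔ (yes p) = mk⇔ (λ _ → p) (λ _ → refl)
does≡true⇔ (no ¬p) = mk⇔ (λ ()) (λ p → ⊥-elim (¬p p))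

≡-swap : {p : A × B} {x : A} {y : B} → p ≡ (x , y) ⇔ swap p ≡ (y , x)
≡-swap = mk⇔ (cong swap) (cong swap)

≡-lhs : {x y z : A} → x ≡ y → x ≡ z ⇔ y ≡ z
≡-lhs refl = mk⇔ id id

module _ {n : ℕ} where

  -- A (block , offset) pair; Fin (n·n) ≅ Cell via combine and remQuot.
  Cell : Set
  Cell = Fin n × Fin n

  _≟²_ : (x y : Cell) → Dec (x ≡ y)
  _≟²_ = ≡-dec _≟_ _≟_

  open import Relation.Binary.Reasoning.Setoid (⇔-setoid 0ℓ)

  Encodes : BinMatrix n → PairMatrix n → Set
  Encodes M π = ∀ s t i j → M (combine s i) (combine t j) ≡ true ⇔ π s t ≡ (i , j)

  blockPositions : (M : BinMatrix n) → OneInEachBlock {n} M → PairMatrix n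
  blockPositions M blocks s t = proj₁ (blocks s t)

  blockPositions-encodes : (M : BinMatrix n) (blocks : OneInEachBlock {n} M) →
                           Encodes M (blockPositions M blocks)
  blockPositions-encodes M blocks s t i j = mk⇔
    (proj₂ (proj₂ (blocks s t)))
    (λ { refl → proj₁ (proj₂ (blocks s t)) })

  entryOf : PairMatrix n → Cell → Cell → Bool
  entryOf π (s , i) (t , j) = does (π s t ≟² (i , j))

  matrixOf : PairMatrix n → BinMatrix n
  matrixOf π r c = entryOf π (remQuot n r) (remQuot n c)

  matrixOf-encodes : (π : PairMatrix n) → Encodes (matrixOf π) π
  matrixOf-encodes π s t i j =
    subst₂ (λ x y → entryOf π x y ≡ true ⇔ π s t ≡ (i , j))
           (sym (remQuot-combine s i)) (sym (remQuot-combine t j))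
           (does≡true⇔ (π s t ≟² (i , j)))

  encodes⇒oneInEachBlock : {M : BinMatrix n} {π : PairMatrix n} →
                           Encodes M π → OneInEachBlock {n} M
  encodes⇒oneInEachBlock {π = π} enc s t =
    π s t , from (enc s t _ _) refl , λ m → to (enc s t _ _) m

  rows⇔ : {M : BinMatrix n} {π : PairMatrix n} → Encodes M π →
          (∀ r → ∃! _≡_ (λ c → M r c ≡ true)) ⇔
          (∀ s → Bijective _≡_ _≡_ (λ t → proj₁ (π s t)))
  rows⇔ {M} {π} enc = begin
    (∀ r → ∃! _≡_ (λ c → M r c ≡ true))
      ≈⟨ ∀-reindex *↔× ⟩
    (∀ ((s , i) : Cell) → ∃! _≡_ (λ c → M (combine s i) c ≡ true))
      ≈⟨ ∀-cong (λ _ → ∃!-reindex *↔×) ⟩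
    (∀ ((s , i) : Cell) → ∃! _≡_ (λ ((t , j) : Cell) →
                             M (combine s i) (combine t j) ≡ true))
      ≈⟨ ∀-cong (λ (s , i) → ∃!-cong (λ (t , j) → enc s t i j)) ⟩
    (∀ ((s , i) : Cell) → ∃! _≡_ (λ ((t , j) : Cell) → π s t ≡ (i , j)))
      ≈⟨ ∀-cong (λ (s , i) → ∃!-fibre (π s) i) ⟩
    (∀ ((s , i) : Cell) → ∃! _≡_ (λ t → proj₁ (π s t) ≡ i))
      ≈⟨ mk⇔ curry uncurry ⟩
    (∀ s i → ∃! _≡_ (λ t → proj₁ (π s t) ≡ i))
      ≈⟨ ∀-cong (λ s → bijective⇔unique-preimages (λ t → proj₁ (π s t))) ⟨
    (∀ s → Bijective _≡_ _≡_ (λ t → proj₁ (π s t)))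
      ∎

  columns⇔ : {M : BinMatrix n} {π : PairMatrix n} → Encodes M π →
             (∀ c → ∃! _≡_ (λ r → M r c ≡ true)) ⇔
             (∀ t → Bijective _≡_ _≡_ (λ s → proj₂ (π s t)))
  columns⇔ {M} {π} enc = begin
    (∀ c → ∃! _≡_ (λ r → M r c ≡ true))
      ≈⟨ ∀-reindex *↔× ⟩
    (∀ ((t , j) : Cell) → ∃! _≡_ (λ r → M r (combine t j) ≡ true))
      ≈⟨ ∀-cong (λ _ → ∃!-reindex *↔×) ⟩
    (∀ ((t , j) : Cell) → ∃! _≡_ (λ ((s , i) : Cell) →
                             M (combine s i) (combine t j) ≡ true))
      ≈⟨ ∀-cong (λ (t , j) → ∃!-cong (λ (s , i) →
           ≡-swap ⇔-∘ enc s t i j)) ⟩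
    (∀ ((t , j) : Cell) → ∃! _≡_ (λ ((s , i) : Cell) → swap (π s t) ≡ (j , i)))
      ≈⟨ ∀-cong (λ (t , j) → ∃!-fibre (λ s → swap (π s t)) j) ⟩
    (∀ ((t , j) : Cell) → ∃! _≡_ (λ s → proj₂ (π s t) ≡ j))
      ≈⟨ mk⇔ curry uncurry ⟩
    (∀ t j → ∃! _≡_ (λ s → proj₂ (π s t) ≡ j))
      ≈⟨ ∀-cong (λ t → bijective⇔unique-preimages (λ s → proj₂ (π s t))) ⟨
    (∀ t → Bijective _≡_ _≡_ (λ s → proj₂ (π s t)))
      ∎

  permutation⇔Pi : {M : BinMatrix n} {π : PairMatrix n} → Encodes M π →
                   IsPermutationMatrix {n} M ⇔ IsPi π
  permutation⇔Pi {M} enc = rows⇔ {M} enc ×-⇔ columns⇔ {M} enc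

  encodings-agree : {M M′ : BinMatrix n} {π π′ : PairMatrix n} →
                    Encodes M π → Encodes M′ π′ →
                    (∀ r c → M r c ≡ M′ r c) ⇔ (∀ s t → π s t ≡ π′ s t)
  encodings-agree {M} {M′} {π} {π′} enc enc′ = mk⇔ positionsAgree entriesAgree
    where
    positionsAgree : (∀ r c → M r c ≡ M′ r c) → ∀ s t → π s t ≡ π′ s t
    positionsAgree M≗M′ s t =
      let (i , j) = π s t
      in sym (to (enc′ s t i j)
               (trans (sym (M≗M′ _ _)) (from (enc s t i j) refl)))

    entriesAgree : (∀ s t → π s t ≡ π′ s t) → ∀ r c → M r c ≡ M′ r c
    entriesAgree π≗π′ r c
      with s , i , refl ← combine-surjective {n} {n} r
         | t , j , refl ← combine-surjective {n} {n} c =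
      ⇔→≡ (begin
        M (combine s i) (combine t j) ≡ true   ≈⟨ enc s t i j ⟩
        π s t ≡ (i , j)                        ≈⟨ ≡-lhs (π≗π′ s t) ⟩
        π′ s t ≡ (i , j)                       ≈⟨ enc′ s t i j ⟨
        M′ (combine s i) (combine t j) ≡ true  ∎)

  SPermutationMatrix : Set
  SPermutationMatrix = Σ (BinMatrix n) (IsSPermutationMatrix {n})

  PiMatrix : Set
  PiMatrix = Σ (PairMatrix n) IsPi

  toPi : SPermutationMatrix → PiMatrix
  toPi (M , perm , blocks) =
    blockPositions M blocks ,
    to (permutation⇔Pi {M} (blockPositions-encodes M blocks)) perm

  toPi-encodes : (A : SPermutationMatrix) → Encodes (proj₁ A) (proj₁ (toPi A))
  toPi-encodes (M , _ , blocks) = blockPositions-encodes M blocks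

  fromPi : PiMatrix → SPermutationMatrix
  fromPi (π , isPi) =
    matrixOf π ,
    from (permutation⇔Pi {matrixOf π} (matrixOf-encodes π)) isPi ,
    encodes⇒oneInEachBlock {matrixOf π} (matrixOf-encodes π)

-- Σ_{n²} ≅ Π_n: toPi respects and reflects entrywise equality because
-- encodings determine each other, and it is onto since any Z equal to
-- fromPi P encodes P, hence has toPi Z equal to P.
lemma2 : (n : ℕ) → 2 ≤ n → Bijection (SigmaSetoid n) (PiSetoid n)
lemma2 n _ = record
  { to        = toPi
  ; cong      = λ {A} {B} → to (agree A B)
  ; bijective = (λ {A} {B} → from (agree A B)) , onto
  }
  where
  agree : (A B : SPermutationMatrix {n}) →
          (∀ r c → proj₁ A r c ≡ proj₁ B r c) ⇔
          (∀ s t → proj₁ (toPi A) s t ≡ proj₁ (toPi B) s t)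
  agree A B = encodings-agree (toPi-encodes A) (toPi-encodes B)

  onto : ∀ (P : PiMatrix {n}) → ∃ λ A → ∀ {Z} →
         (∀ r c → proj₁ Z r c ≡ proj₁ A r c) →
         ∀ s t → proj₁ (toPi Z) s t ≡ proj₁ P s t
  onto P = fromPi P , λ {Z} →
    to (encodings-agree (toPi-encodes Z) (matrixOf-encodes (proj₁ P)))
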